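{- Let $\lambda=(\lambda_1,\dots,\lambda_l)$ be a partition (with $l\ge 2$, allowing zero parts), $n\in N(\lambda)$, and write $n=|\lambda|+2r$. Let $\bar\lambda=(\lambda_1+r,\lambda_2+r,\lambda_3,\dots,\lambda_l)$. Then $\bar\lambda\in V^n(\lambda)$ and $\bar\lambda$ is the maximum element of $V^n(\lambda)$ with respect to the dominance order, i.e. $\nu\le\bar\lambda$ for every $\nu\in V^n(\lambda)$.
   Context: $N(\lambda)=\{n\ge|\lambda|: n\equiv|\lambda|\pmod 2\}$. A skew shape is a vertical strip if it has at most one box in each row. $V^n(\lambda)$ is the set of partitions $\nu$ with $|\nu|=n$ admitting a chain $\lambda=\nu^0\subseteq\nu^1\subseteq\dots\subseteq\nu^t=\nu$ of partitions with each $\nu^s/\nu^{s-1}$ a vertical strip of even size. Dominance order on partitions of the same size: $\alpha\ge\beta$ iff $\alpha_1+\dots+\alpha_i\ge\beta_1+\dots+\beta_i$ for all $i$ (padding with zeros). -}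

module Defs where

open import Data.Nat using (ℕ; zero; suc; _+_; _*_; _∸_; _≤_)
open import Data.Nat.Divisibility using (_∣_)
open import Data.List using (List; []; _∷_)
open import Data.Nat.ListAction using (sum)
open import Data.Product using (_×_)
open import Relation.Binary.PropositionalEquality using (_≡_)

-- A partition is a finite list of naturals, read with implicit trailing zeros.
-- at p i = i-th part (0-indexed), 0 beyond the end of the list.
at : List ℕ → ℕ → ℕ
at []       _       = 0
at (x ∷ _)  zero    = x
at (_ ∷ xs) (suc i) = at xs i

IsPartition : List ℕ → Set
IsPartition p = ∀ i → at p (suc i) ≤ at p i

size : List ℕ → ℕ
size = sum

_⊆ᵖ_ : List ℕ → List ℕ → Set
μ ⊆ᵖ ν = ∀ i → at μ i ≤ at ν i

VerticalStrip : List ℕ → List ℕ → Set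
VerticalStrip μ ν = μ ⊆ᵖ ν × (∀ i → at ν i ≤ suc (at μ i))

data Chain (λ' : List ℕ) : List ℕ → Set where
  base : Chain λ' λ'
  step : ∀ {μ ν} → Chain λ' μ → IsPartition ν → VerticalStrip μ ν →
         2 ∣ (size ν ∸ size μ) → Chain λ' ν

V : ℕ → List ℕ → List ℕ → Set
V n λ' ν = IsPartition ν × size ν ≡ n × Chain λ' ν

psum : List ℕ → ℕ → ℕ
psum p zero    = 0
psum p (suc i) = psum p i + at p i

_⊵_ : List ℕ → List ℕ → Set
α ⊵ β = ∀ i → psum β i ≤ psum α i

-- Only the first row needs an argument.  A vertical strip
-- adds at most one box to the first row, and when it does, its size is positive
-- and even, hence at least 2; so along a chain the first row grows by at most
-- half of the total growth, giving ν₁ ≤ λ₁ + r.  For i ≥ 2 the sum of the first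
-- i parts of any ν ⊇ λ grows by at most |ν| − |λ| = 2r, which λ̄ attains.
-- Raising the first two rows one box at a time exhibits λ̄ ∈ Vⁿ(λ).
module Submission where

open import Defs
open import Data.Nat using (ℕ; zero; suc; _+_; _*_; _∸_; _≤_; _<_; z≤n; _≤?_)
open import Data.Nat.Properties
open import Algebra.Properties.CommutativeSemigroup +-commutativeSemigroup using (interchange; xy∙z≈xz∙y)
open import Data.Nat.Divisibility using (_∣_; divides; ∣-refl)
open import Data.Nat.Tactic.RingSolver using (solve-∀)
open import Data.List using (List; []; _∷_)
open import Data.Product using (_×_; _,_)
open import Relation.Binary.PropositionalEquality
open import Relation.Nullary using (yes; no; contradiction)

psum-[] : ∀ i → psum [] i ≡ 0
psum-[] zero    = refl
psum-[] (suc i) = cong (_+ 0) (psum-[] i)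

psum-∷ : ∀ x xs i → psum (x ∷ xs) (suc i) ≡ x + psum xs i
psum-∷ x xs zero    = sym (+-identityʳ x)
psum-∷ x xs (suc i) = trans (cong (_+ at xs i) (psum-∷ x xs i)) (+-assoc x (psum xs i) (at xs i))

psum≤size : ∀ p i → psum p i ≤ size p
psum≤size []       i       = ≤-reflexive (psum-[] i)
psum≤size (x ∷ xs) zero    = z≤n
psum≤size (x ∷ xs) (suc i) = subst (_≤ size (x ∷ xs)) (sym (psum-∷ x xs i))
                               (+-monoʳ-≤ x (psum≤size xs i))

size-mono : ∀ μ ν → μ ⊆ᵖ ν → size μ ≤ size ν
size-mono []       ν        μ⊆ν = z≤n
size-mono (x ∷ xs) []       μ⊆ν = +-mono-≤ (μ⊆ν 0) (size-mono xs [] (λ i → μ⊆ν (suc i)))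
size-mono (x ∷ xs) (y ∷ ys) μ⊆ν = +-mono-≤ (μ⊆ν 0) (size-mono xs ys (λ i → μ⊆ν (suc i)))

-- The part of ν below row i is at least that of μ; stated additively to avoid ∸.
psum+size-mono : ∀ μ ν i → μ ⊆ᵖ ν → psum ν i + size μ ≤ psum μ i + size ν
psum+size-mono μ        ν        zero    μ⊆ν = size-mono μ ν μ⊆ν
psum+size-mono []       ν        (suc i) μ⊆ν = begin
  psum ν (suc i) + 0 ≡⟨ +-identityʳ _ ⟩
  psum ν (suc i)     ≤⟨ psum≤size ν (suc i) ⟩
  size ν             ≡⟨ cong (_+ size ν) (sym (psum-[] (suc i))) ⟩
  psum [] (suc i) + size ν ∎
  where open ≤-Reasoning
psum+size-mono (x ∷ xs) []       (suc i) μ⊆ν =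
  subst (_≤ psum (x ∷ xs) (suc i) + 0) (cong (_+ size (x ∷ xs)) (sym (psum-[] (suc i))))
    (≤-trans (size-mono (x ∷ xs) [] μ⊆ν) z≤n)
psum+size-mono (x ∷ xs) (y ∷ ys) (suc i) μ⊆ν = begin
  psum (y ∷ ys) (suc i) + size (x ∷ xs) ≡⟨ cong₂ _+_ (psum-∷ y ys i) refl ⟩
  y + psum ys i + (x + size xs)         ≡⟨ interchange y (psum ys i) x (size xs) ⟩
  y + x + (psum ys i + size xs)         ≤⟨ +-monoʳ-≤ (y + x) (psum+size-mono xs ys i (λ j → μ⊆ν (suc j))) ⟩
  y + x + (psum xs i + size ys)         ≡⟨ cong (_+ (psum xs i + size ys)) (+-comm y x) ⟩
  x + y + (psum xs i + size ys)         ≡⟨ interchange x (psum xs i) y (size ys) ⟨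
  x + psum xs i + (y + size ys)         ≡⟨ cong₂ _+_ (sym (psum-∷ x xs i)) refl ⟩
  psum (x ∷ xs) (suc i) + size (y ∷ ys) ∎
  where open ≤-Reasoning

even-gap : ∀ {m n} → m < n → 2 ∣ (n ∸ m) → 2 + m ≤ n
even-gap {m} {n} m<n (divides zero n∸m≡0) =
  contradiction (m∸n≡0⇒m≤n n∸m≡0) (<⇒≱ m<n)
even-gap {m} {n} m<n (divides (suc k) n∸m≡2+2k) = begin
  2 + m               ≡⟨ +-comm 2 m ⟩
  m + 2               ≤⟨ +-monoʳ-≤ m (m≤m+n 2 (k * 2)) ⟩
  m + suc k * 2       ≡⟨ cong (m +_) n∸m≡2+2k ⟨
  m + (n ∸ m)         ≡⟨ m+[n∸m]≡n (<⇒≤ m<n) ⟩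
  n                   ∎
  where open ≤-Reasoning

strip-firstRow-bound : ∀ {μ ν} → VerticalStrip μ ν → 2 ∣ (size ν ∸ size μ) →
                       2 * at ν 0 + size μ ≤ 2 * at μ 0 + size ν
strip-firstRow-bound {μ} {ν} (μ⊆ν , thin) even with at ν 0 ≤? at μ 0
... | yes stays = +-mono-≤ (*-monoʳ-≤ 2 stays) (size-mono μ ν μ⊆ν)
... | no grows  = begin
  2 * at ν 0 + size μ         ≡⟨ cong (λ k → 2 * k + size μ) ν₀≡1+μ₀ ⟩
  2 * suc (at μ 0) + size μ   ≡⟨ shift (at μ 0) (size μ) ⟩
  2 * at μ 0 + (2 + size μ)   ≤⟨ +-monoʳ-≤ (2 * at μ 0) (even-gap sizeGrows even) ⟩
  2 * at μ 0 + size ν         ∎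
  where
  open ≤-Reasoning
  ν₀≡1+μ₀ : at ν 0 ≡ suc (at μ 0)
  ν₀≡1+μ₀ = ≤-antisym (thin 0) (≰⇒> grows)
  sizeGrows : size μ < size ν
  sizeGrows = +-cancelˡ-≤ (at μ 0) _ _ (begin
    at μ 0 + suc (size μ) ≡⟨ +-suc (at μ 0) (size μ) ⟩
    suc (at μ 0) + size μ ≡⟨ cong (_+ size μ) ν₀≡1+μ₀ ⟨
    at ν 0 + size μ       ≤⟨ psum+size-mono μ ν 1 μ⊆ν ⟩
    at μ 0 + size ν       ∎)
  shift : ∀ m s → 2 * suc m + s ≡ 2 * m + (2 + s)
  shift = solve-∀

Chain⇒⊆ᵖ : ∀ {λ' ν} → Chain λ' ν → λ' ⊆ᵖ ν
Chain⇒⊆ᵖ base                       i = ≤-refl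
Chain⇒⊆ᵖ (step c _ (μ⊆ν , _) _) i = ≤-trans (Chain⇒⊆ᵖ c i) (μ⊆ν i)

Chain⇒firstRow-bound : ∀ {λ' ν} → Chain λ' ν → 2 * at ν 0 + size λ' ≤ 2 * at λ' 0 + size ν
Chain⇒firstRow-bound base = ≤-refl
Chain⇒firstRow-bound {λ'} {ν} (step {μ} c _ strip even) =
  +-cancelʳ-≤ (size μ) _ _ (begin
    2 * at ν 0 + size λ' + size μ   ≡⟨ xy∙z≈xz∙y (2 * at ν 0) (size λ') (size μ) ⟩
    2 * at ν 0 + size μ + size λ'   ≤⟨ +-monoˡ-≤ (size λ') (strip-firstRow-bound {μ} {ν} strip even) ⟩
    2 * at μ 0 + size ν + size λ'   ≡⟨ xy∙z≈xz∙y (2 * at μ 0) (size ν) (size λ') ⟩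
    2 * at μ 0 + size λ' + size ν   ≤⟨ +-monoˡ-≤ (size ν) (Chain⇒firstRow-bound c) ⟩
    2 * at λ' 0 + size μ + size ν   ≡⟨ xy∙z≈xz∙y (2 * at λ' 0) (size μ) (size ν) ⟩
    2 * at λ' 0 + size ν + size μ   ∎)
  where open ≤-Reasoning

Chain⇒firstRow≤ : ∀ {λ' ν} r → Chain λ' ν → size ν ≡ size λ' + 2 * r → at ν 0 ≤ at λ' 0 + r
Chain⇒firstRow≤ {λ'} {ν} r c |ν| = *-cancelˡ-≤ 2 (+-cancelʳ-≤ (size λ') _ _ (begin
  2 * at ν 0 + size λ'          ≤⟨ Chain⇒firstRow-bound c ⟩
  2 * at λ' 0 + size ν          ≡⟨ cong (2 * at λ' 0 +_) |ν| ⟩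
  2 * at λ' 0 + (size λ' + 2 * r) ≡⟨ regroup (at λ' 0) (size λ') r ⟩
  2 * (at λ' 0 + r) + size λ'   ∎))
  where
  open ≤-Reasoning
  regroup : ∀ a s r → 2 * a + (s + 2 * r) ≡ 2 * (a + r) + s
  regroup = solve-∀

⊆ᵖ⇒psum≤ : ∀ {μ ν} d i → μ ⊆ᵖ ν → size ν ≡ size μ + d → psum ν i ≤ psum μ i + d
⊆ᵖ⇒psum≤ {μ} {ν} d i μ⊆ν |ν| = +-cancelʳ-≤ (size μ) _ _ (begin
  psum ν i + size μ         ≤⟨ psum+size-mono μ ν i μ⊆ν ⟩
  psum μ i + size ν         ≡⟨ cong (psum μ i +_) |ν| ⟩
  psum μ i + (size μ + d)   ≡⟨ cong (psum μ i +_) (+-comm (size μ) d) ⟩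
  psum μ i + (d + size μ)   ≡⟨ +-assoc (psum μ i) d (size μ) ⟨
  psum μ i + d + size μ     ∎)
  where open ≤-Reasoning

raise₂-isPartition : ∀ {a b rest} → IsPartition (a ∷ b ∷ rest) → ∀ k →
                     IsPartition (a + k ∷ b + k ∷ rest)
raise₂-isPartition p k zero          = +-monoˡ-≤ k (p 0)
raise₂-isPartition p k (suc zero)    = ≤-trans (p 1) (m≤m+n _ k)
raise₂-isPartition p k (suc (suc i)) = p (suc (suc i))

raise₂-verticalStrip : ∀ x y rest → VerticalStrip (x ∷ y ∷ rest) (suc x ∷ suc y ∷ rest)
raise₂-verticalStrip x y rest = contained , thin
  where
  contained : (x ∷ y ∷ rest) ⊆ᵖ (suc x ∷ suc y ∷ rest)
  contained zero          = n≤1+n x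
  contained (suc zero)    = n≤1+n y
  contained (suc (suc i)) = ≤-refl
  thin : ∀ i → at (suc x ∷ suc y ∷ rest) i ≤ suc (at (x ∷ y ∷ rest) i)
  thin zero          = ≤-refl
  thin (suc zero)    = ≤-refl
  thin (suc (suc i)) = n≤1+n _

raise₂-sum : ∀ a b s r → a + r + (b + r + s) ≡ a + (b + s) + 2 * r
raise₂-sum = solve-∀

raise₂-sizeStep : ∀ x y rest → size (suc x ∷ suc y ∷ rest) ∸ size (x ∷ y ∷ rest) ≡ 2
raise₂-sizeStep x y rest = begin
  size (suc x ∷ suc y ∷ rest) ∸ size (x ∷ y ∷ rest)
    ≡⟨ cong (_∸ size (x ∷ y ∷ rest)) (twoMore x y (size rest)) ⟩
  2 + size (x ∷ y ∷ rest) ∸ size (x ∷ y ∷ rest)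
    ≡⟨ m+n∸n≡m 2 (size (x ∷ y ∷ rest)) ⟩
  2 ∎
  where
  open ≡-Reasoning
  twoMore : ∀ x y s → suc x + (suc y + s) ≡ 2 + (x + (y + s))
  twoMore = solve-∀

raise₂-Chain : ∀ {a b rest} → IsPartition (a ∷ b ∷ rest) → ∀ k →
               Chain (a ∷ b ∷ rest) (a + k ∷ b + k ∷ rest)
raise₂-Chain {a} {b} p zero rewrite +-identityʳ a | +-identityʳ b = base
raise₂-Chain {a} {b} {rest} p (suc k) rewrite +-suc a k | +-suc b k =
  step (raise₂-Chain p k)
       (subst₂ (λ u v → IsPartition (u ∷ v ∷ rest)) (+-suc a k) (+-suc b k) (raise₂-isPartition p (suc k)))
       (raise₂-verticalStrip (a + k) (b + k) rest)
       (subst (2 ∣_) (sym (raise₂-sizeStep (a + k) (b + k) rest)) ∣-refl)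

raise₂-psum : ∀ a b rest r j →
              psum (a + r ∷ b + r ∷ rest) (2 + j) ≡ psum (a ∷ b ∷ rest) (2 + j) + 2 * r
raise₂-psum a b rest r j = begin
  psum (a + r ∷ b + r ∷ rest) (2 + j) ≡⟨ psum-∷ (a + r) _ (suc j) ⟩
  a + r + psum (b + r ∷ rest) (1 + j) ≡⟨ cong (a + r +_) (psum-∷ (b + r) rest j) ⟩
  a + r + (b + r + psum rest j)       ≡⟨ raise₂-sum a b (psum rest j) r ⟩
  a + (b + psum rest j) + 2 * r       ≡⟨ cong (λ s → a + s + 2 * r) (psum-∷ b rest j) ⟨
  a + psum (b ∷ rest) (1 + j) + 2 * r ≡⟨ cong (_+ 2 * r) (psum-∷ a (b ∷ rest) (suc j)) ⟨
  psum (a ∷ b ∷ rest) (2 + j) + 2 * r ∎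
  where open ≡-Reasoning

lemma4p15 : (a b : ℕ) (rest : List ℕ) → IsPartition (a ∷ b ∷ rest) → (r : ℕ) →
    V (size (a ∷ b ∷ rest) + 2 * r) (a ∷ b ∷ rest) ((a + r) ∷ (b + r) ∷ rest)
    × (∀ ν → V (size (a ∷ b ∷ rest) + 2 * r) (a ∷ b ∷ rest) ν → ((a + r) ∷ (b + r) ∷ rest) ⊵ ν)
lemma4p15 a b rest p r =
  (raise₂-isPartition p r , raise₂-sum a b (size rest) r , raise₂-Chain p r) , dominates
  where
  dominates : ∀ ν → V (size (a ∷ b ∷ rest) + 2 * r) (a ∷ b ∷ rest) ν → ((a + r) ∷ (b + r) ∷ rest) ⊵ ν
  dominates ν _             zero          = z≤n
  dominates ν (_ , |ν| , c) (suc zero)    = Chain⇒firstRow≤ r c |ν|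
  dominates ν (_ , |ν| , c) (suc (suc j)) =
    subst (psum ν (2 + j) ≤_) (sym (raise₂-psum a b rest r j))
          (⊆ᵖ⇒psum≤ (2 * r) (2 + j) (Chain⇒⊆ᵖ c) |ν|)
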